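{- In the Mockingbird CLS, a combinator $\mathfrak{t}$ is a maximal element of the poset $\mathcal{P}$ if and only if $\mathfrak{t}$ avoids ${\rm M}(\mathsf{x}_1\mathsf{x}_2)$, and $\mathfrak{t}$ is a minimal element of $\mathcal{P}$ if and only if $\mathfrak{t}$ avoids $(\mathsf{x}_1\mathsf{x}_2)(\mathsf{x}_1\mathsf{x}_2)$.
   Context: Terms over $\{{\rm M}\}$ are the smallest set containing the variables $\mathsf{x}_1,\mathsf{x}_2,\dots$, the symbol ${\rm M}$, and $(\mathfrak{t}_1\mathfrak{t}_2)$ for terms $\mathfrak{t}_1,\mathfrak{t}_2$ (binary trees; application associates to the left). A combinator is a term containing no variable. For terms $\mathfrak{t},\mathfrak{s}_1,\dots,\mathfrak{s}_n$, $\mathfrak{t}[\mathfrak{s}_1,\dots,\mathfrak{s}_n]$ is obtained by simultaneously replacing each occurrence of $\mathsf{x}_i$ in $\mathfrak{t}$ by $\mathfrak{s}_i$. A term $\mathfrak{s}$ is a factor of $\mathfrak{t}$ if $\mathfrak{t} = \mathfrak{t}'[\mathfrak{s}_1,\dots,\mathfrak{s}_{i-1},\mathfrak{s},\mathfrak{s}_{i+1},\dots,\mathfrak{s}_n][\mathfrak{r}_1,\dots,\mathfrak{r}_m]$ for some $n,m\ge 0$ and terms $\mathfrak{t}',\mathfrak{s}_j,\mathfrak{r}_j$ where $\mathsf{x}_i$ appears in $\mathfrak{t}'$; otherwise $\mathfrak{t}$ avoids $\mathfrak{s}$. The rewrite relation $\Rightarrow$ is the smallest relation with ${\rm M}\,\mathfrak{s}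 \Rightarrow \mathfrak{s}\,\mathfrak{s}$ for every term $\mathfrak{s}$ and closed under $\mathfrak{t}_1 \Rightarrow \mathfrak{t}_1'$ implies $\mathfrak{t}_1\mathfrak{t}_2 \Rightarrow \mathfrak{t}_1'\mathfrak{t}_2$ and $\mathfrak{t}_2\mathfrak{t}_1 \Rightarrow \mathfrak{t}_2\mathfrak{t}_1'$. Its reflexive-transitive closure $\preccurlyeq$ is a partial order, and $\mathcal{P}$ is the poset of all terms ordered by $\preccurlyeq$. -}

module Defs where

open import Data.Nat using (ℕ; zero; suc)
open import Data.List using (List; []; _∷_; _++_; length)
open import Data.Product using (Σ; _×_)
open import Relation.Nullary using (¬_)
open import Relation.Binary.PropositionalEquality using (_≡_)
open import Relation.Binary.Construct.Closure.ReflexiveTransitive using (Star)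

-- Terms over {M}.  The variable x_{i+1} is represented by  var i  (0-based index).
infixl 9 _·_
data Term : Set where
  var : ℕ → Term
  M   : Term
  _·_ : Term → Term → Term

x₁ x₂ : Term
x₁ = var 0
x₂ = var 1

data _occursIn_ (i : ℕ) : Term → Set where
  here  : i occursIn var i
  left  : ∀ {t u} → i occursIn t → i occursIn (t · u)
  right : ∀ {t u} → i occursIn u → i occursIn (t · u)

Combinator : Term → Set
Combinator t = ∀ i → ¬ (i occursIn t)

lookupVar : List Term → ℕ → Term
lookupVar []       i       = var i
lookupVar (s ∷ ss) zero    = s
lookupVar (s ∷ ss) (suc i) = lookupVar ss i

_[_] : Term → List Term → Term
var i   [ ss ] = lookupVar ss i
M       [ ss ] = M
(t · u) [ ss ] = (t [ ss ]) · (u [ ss ])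

-- s is a factor of t:  t = t'[s₁,…,s_{i-1}, s, s_{i+1},…,sₙ][r₁,…,r_m]
-- with x_i appearing in t'  (here i-1 = length pre).
IsFactor : Term → Term → Set
IsFactor s t =
  Σ Term λ t' → Σ (List Term) λ pre → Σ (List Term) λ post → Σ (List Term) λ rs →
    (length pre occursIn t') × (t ≡ ((t' [ pre ++ (s ∷ post) ]) [ rs ]))

Avoids : Term → Term → Set
Avoids t s = ¬ IsFactor s t

infix 4 _⇒_
data _⇒_ : Term → Term → Set where
  mock : ∀ s → M · s ⇒ s · s
  appˡ : ∀ {t t' u} → t ⇒ t' → t · u ⇒ t' · u
  appʳ : ∀ {t u u'} → u ⇒ u' → t · u ⇒ t · u'

infix 4 _≼_
_≼_ : Term → Term → Set
_≼_ = Star _⇒_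

Maximal : Term → Set
Maximal t = ∀ s → t ≼ s → s ≡ t

Minimal : Term → Set
Minimal t = ∀ s → s ≼ t → s ≡ t

-- A rewrite step contracts one redex M u inside a one-hole context C, turning C⟨M u⟩
-- into C⟨u u⟩; it leaves the term unchanged exactly when u = M.  Inside a combinator
-- the argument u is closed, hence either M or an application a b.  So a combinator has
-- a reduct other than itself iff it contains a subterm M (a b), and a predecessor other
-- than itself iff it contains a subterm (a b)(a b).  Finally, for a combinator t, being
-- a factor of t means precisely that some instance of the pattern is a subterm of t.
module Submission where

open import Defs
open import Data.List using (List; []; _∷_; _++_; length)
open import Data.Product using (Σ; _×_; _,_)
open import Function.Bundles using (_⇔_; mk⇔)
open import Relation.Binary.Core using (Rel)
open import Relation.Binary.PropositionalEquality
  using (_≡_; _≢_; refl; sym; cong; cong₂; module ≡-Reasoning)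
open import Relation.Binary.Construct.Closure.ReflexiveTransitive using (Star; ε; _◅_; return)

module _ {a ℓ} {A : Set a} {_⟶_ : Rel A ℓ} where

  Star-fixedˡ : ∀ {x y} → (∀ {z} → x ⟶ z → z ≡ x) → Star _⟶_ x y → y ≡ x
  Star-fixedˡ fixed ε = refl
  Star-fixedˡ fixed (step ◅ steps) with fixed step
  ... | refl = Star-fixedˡ fixed steps

  Star-fixedʳ : ∀ {x y} → (∀ {z} → z ⟶ y → z ≡ y) → Star _⟶_ x y → x ≡ y
  Star-fixedʳ fixed ε = refl
  Star-fixedʳ fixed (step ◅ steps) with Star-fixedʳ fixed steps
  ... | refl = fixed step

·-injectiveˡ : ∀ {t t′ u u′} → t · u ≡ t′ · u′ → t ≡ t′
·-injectiveˡ refl = refl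

·-injectiveʳ : ∀ {t t′ u u′} → t · u ≡ t′ · u′ → u ≡ u′
·-injectiveʳ refl = refl

lookupVar-++-length : ∀ pre (s : Term) post → lookupVar (pre ++ s ∷ post) (length pre) ≡ s
lookupVar-++-length []        s post = refl
lookupVar-++-length (_ ∷ pre) s post = lookupVar-++-length pre s post

Combinator-[] : ∀ {c} ss → Combinator c → c [ ss ] ≡ c
Combinator-[] {var i} ss closed with () ← closed i here
Combinator-[] {M}     ss closed = refl
Combinator-[] {t · u} ss closed =
  cong₂ _·_ (Combinator-[] ss (λ i o → closed i (left o)))
            (Combinator-[] ss (λ i o → closed i (right o)))

infixl 9 _◂_
infixr 9 _▸_
infix 21 _⟨_⟩

data Context : Set where
  □   : Context
  _◂_ : Context → Term → Context
  _▸_ : Term → Context → Context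

_⟨_⟩ : Context → Term → Term
□       ⟨ r ⟩ = r
(C ◂ u) ⟨ r ⟩ = C ⟨ r ⟩ · u
(t ▸ C) ⟨ r ⟩ = t · C ⟨ r ⟩

_[_]ᶜ : Context → List Term → Context
□       [ ss ]ᶜ = □
(C ◂ u) [ ss ]ᶜ = C [ ss ]ᶜ ◂ u [ ss ]
(t ▸ C) [ ss ]ᶜ = t [ ss ] ▸ C [ ss ]ᶜ

⟨⟩-injective : ∀ C {r r′} → C ⟨ r ⟩ ≡ C ⟨ r′ ⟩ → r ≡ r′
⟨⟩-injective □       eq = eq
⟨⟩-injective (C ◂ u) eq = ⟨⟩-injective C (·-injectiveˡ eq)
⟨⟩-injective (t ▸ C) eq = ⟨⟩-injective C (·-injectiveʳ eq)

⟨⟩-[] : ∀ C r ss → (C ⟨ r ⟩) [ ss ] ≡ (C [ ss ]ᶜ) ⟨ r [ ss ] ⟩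
⟨⟩-[] □       r ss = refl
⟨⟩-[] (C ◂ u) r ss = cong (_· u [ ss ]) (⟨⟩-[] C r ss)
⟨⟩-[] (t ▸ C) r ss = cong (t [ ss ] ·_) (⟨⟩-[] C r ss)

⟨⟩-occurs : ∀ C {i r} → i occursIn r → i occursIn C ⟨ r ⟩
⟨⟩-occurs □       o = o
⟨⟩-occurs (C ◂ u) o = left (⟨⟩-occurs C o)
⟨⟩-occurs (t ▸ C) o = right (⟨⟩-occurs C o)

occurs⇒context : ∀ {i t} → i occursIn t → Σ Context λ C → t ≡ C ⟨ var i ⟩
occurs⇒context here = □ , refl
occurs⇒context (left {u = u} o) with C , refl ← occurs⇒context o = C ◂ u , refl
occurs⇒context (right {t = t} o) with C , refl ← occurs⇒context o = t ▸ C , refl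

Combinator-[]ᶜ : ∀ C {r} ss → Combinator (C ⟨ r ⟩) → C [ ss ]ᶜ ≡ C
Combinator-[]ᶜ □       ss closed = refl
Combinator-[]ᶜ (C ◂ u) ss closed =
  cong₂ _◂_ (Combinator-[]ᶜ C ss (λ i o → closed i (left o)))
            (Combinator-[] ss (λ i o → closed i (right o)))
Combinator-[]ᶜ (t ▸ C) ss closed =
  cong₂ _▸_ (Combinator-[] ss (λ i o → closed i (left o)))
            (Combinator-[]ᶜ C ss (λ i o → closed i (right o)))

⟨⟩-⇒ : ∀ C {r r′} → r ⇒ r′ → C ⟨ r ⟩ ⇒ C ⟨ r′ ⟩
⟨⟩-⇒ □       step = step
⟨⟩-⇒ (C ◂ u) step = appˡ (⟨⟩-⇒ C step)
⟨⟩-⇒ (t ▸ C) step = appʳ (⟨⟩-⇒ C step)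

⇒-redex : ∀ {t s} → t ⇒ s → Σ Context λ C → Σ Term λ u → t ≡ C ⟨ M · u ⟩ × s ≡ C ⟨ u · u ⟩
⇒-redex (mock u) = □ , u , refl , refl
⇒-redex (appˡ {u = v} step) with C , u , refl , refl ← ⇒-redex step = C ◂ v , u , refl , refl
⇒-redex (appʳ {t = v} step) with C , u , refl , refl ← ⇒-redex step = v ▸ C , u , refl , refl

IsFactor⇒instance : ∀ {s t} → IsFactor s t →
  Σ Context λ C → Σ (List Term) λ rs → t ≡ C ⟨ s [ rs ] ⟩
IsFactor⇒instance {s} (t′ , pre , post , rs , occurs , refl)
  with C , refl ← occurs⇒context occurs = (C [ L ]ᶜ) [ rs ]ᶜ , rs , instance-eq
  where
  open ≡-Reasoning
  L : List Term
  L = pre ++ s ∷ post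
  instance-eq : ((C ⟨ var (length pre) ⟩) [ L ]) [ rs ] ≡ ((C [ L ]ᶜ) [ rs ]ᶜ) ⟨ s [ rs ] ⟩
  instance-eq = begin
    ((C ⟨ var (length pre) ⟩) [ L ]) [ rs ]        ≡⟨ cong (_[ rs ]) (⟨⟩-[] C (var (length pre)) L) ⟩
    ((C [ L ]ᶜ) ⟨ lookupVar L (length pre) ⟩) [ rs ] ≡⟨ cong (λ r → ((C [ L ]ᶜ) ⟨ r ⟩) [ rs ])
                                                            (lookupVar-++-length pre s post) ⟩
    ((C [ L ]ᶜ) ⟨ s ⟩) [ rs ]                        ≡⟨ ⟨⟩-[] (C [ L ]ᶜ) s rs ⟩
    ((C [ L ]ᶜ) [ rs ]ᶜ) ⟨ s [ rs ] ⟩                ∎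

instance⇒IsFactor : ∀ {s t} C rs → Combinator t → t ≡ C ⟨ s [ rs ] ⟩ → IsFactor s t
instance⇒IsFactor {s} C rs closed refl =
  C ⟨ var 0 ⟩ , [] , [] , rs , ⟨⟩-occurs C here , sym instance-eq
  where
  open ≡-Reasoning
  instance-eq : ((C ⟨ var 0 ⟩) [ s ∷ [] ]) [ rs ] ≡ C ⟨ s [ rs ] ⟩
  instance-eq = begin
    ((C ⟨ var 0 ⟩) [ s ∷ [] ]) [ rs ]        ≡⟨ cong (_[ rs ]) (⟨⟩-[] C (var 0) (s ∷ [])) ⟩
    ((C [ s ∷ [] ]ᶜ) ⟨ s ⟩) [ rs ]           ≡⟨ ⟨⟩-[] (C [ s ∷ [] ]ᶜ) s rs ⟩
    ((C [ s ∷ [] ]ᶜ) [ rs ]ᶜ) ⟨ s [ rs ] ⟩   ≡⟨ cong (λ D → (D [ rs ]ᶜ) ⟨ s [ rs ] ⟩)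
                                                    (Combinator-[]ᶜ C (s ∷ []) closed) ⟩
    (C [ rs ]ᶜ) ⟨ s [ rs ] ⟩                 ≡⟨ cong (_⟨ s [ rs ] ⟩) (Combinator-[]ᶜ C rs closed) ⟩
    C ⟨ s [ rs ] ⟩                           ∎

⇒-fixed-unless-M·app : ∀ {t s} → Combinator t → (∀ C a b → t ≢ C ⟨ M · (a · b) ⟩) →
  t ⇒ s → s ≡ t
⇒-fixed-unless-M·app closed none step with ⇒-redex step
... | C , var i , refl , refl with () ← closed i (⟨⟩-occurs C (right here))
... | C , M     , refl , refl = refl
... | C , a · b , refl , refl with () ← none C a b refl

⇒-fixed-unless-app·app : ∀ {t s} → Combinator s → (∀ C a b → s ≢ C ⟨ (a · b) · (a · b) ⟩) →
  t ⇒ s → t ≡ s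
⇒-fixed-unless-app·app closed none step with ⇒-redex step
... | C , var i , refl , refl with () ← closed i (⟨⟩-occurs C (left here))
... | C , M     , refl , refl = refl
... | C , a · b , refl , refl with () ← none C a b refl

Maximal⇒no-M·app : ∀ {t} → Maximal t → ∀ C a b → t ≢ C ⟨ M · (a · b) ⟩
Maximal⇒no-M·app maximal C a b refl
  with () ← ⟨⟩-injective C (maximal _ (return (⟨⟩-⇒ C (mock (a · b)))))

Minimal⇒no-app·app : ∀ {t} → Minimal t → ∀ C a b → t ≢ C ⟨ (a · b) · (a · b) ⟩
Minimal⇒no-app·app minimal C a b refl
  with () ← ⟨⟩-injective C (minimal _ (return (⟨⟩-⇒ C (mock (a · b)))))

no-M·app⇒Maximal : ∀ {t} → Combinator t → (∀ C a b → t ≢ C ⟨ M · (a · b) ⟩) → Maximal t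
no-M·app⇒Maximal closed none s = Star-fixedˡ (⇒-fixed-unless-M·app closed none)

no-app·app⇒Minimal : ∀ {t} → Combinator t → (∀ C a b → t ≢ C ⟨ (a · b) · (a · b) ⟩) → Minimal t
no-app·app⇒Minimal closed none s = Star-fixedʳ (⇒-fixed-unless-app·app closed none)

proposition2p2 : (t : Term) → Combinator t →
    (Maximal t ⇔ Avoids t (M · (x₁ · x₂))) × (Minimal t ⇔ Avoids t ((x₁ · x₂) · (x₁ · x₂)))
proposition2p2 t closed =
    mk⇔ (λ maximal factor → let C , rs , eq = IsFactor⇒instance factor in
                            Maximal⇒no-M·app maximal C _ _ eq)
        (λ avoids → no-M·app⇒Maximal closed λ C a b eq →
                      avoids (instance⇒IsFactor C (a ∷ b ∷ []) closed eq))
  , mk⇔ (λ minimal factor → let C , rs , eq = IsFactor⇒instance factor in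
                            Minimal⇒no-app·app minimal C _ _ eq)
        (λ avoids → no-app·app⇒Minimal closed λ C a b eq →
                      avoids (instance⇒IsFactor C (a ∷ b ∷ []) closed eq))
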